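{- Let $\alpha,\beta\ge 0$ be integers and let $Z_{\alpha,\beta}$ be the graph consisting of a centre vertex $v$ together with $2\beta+1$ paths, each having $\alpha+1$ vertices other than $v$, attached at $v$ (pairwise disjoint except at $v$), so that $Z_{\alpha,\beta}$ has $n=1+(2\beta+1)(\alpha+1)$ vertices. Then for $n$ robots, there is no way to add at most $\alpha$ new vertices and at most $\beta$ new edges (each new edge joining two vertices of $Z_{\alpha,\beta}$, a vertex of $Z_{\alpha,\beta}$ and a new vertex, or two new vertices) so that the resulting graph is universally solvable for $n$ robots.
   Context: Robots are $R=[p]$; a configuration on a graph $H=(W,F)$ is an injective map $S:R\to W$. A pair $(S,S')$ of configurations is a valid move if it is one of: (i) a simple path move: there is a simple path $(u_0,\dots,u_k)$ in $H$ with $u_k\notin S(R)$, $u_0\notin S'(R)$, $S'(i)=S(i)$ for robots not on the path, and $S'(i)=u_{j+1}$ whenever $S(i)=u_j$, $0\le j\le k-1$; (ii) a simple rotation move: there is a simple cycle $(u_0,\dots,u_{k-1},u_k=u_0)$ in $H$ all of whose vertices are occupied in $S$ and in $S'$, robots off the cycle stay fixed, and $S'(i)=u_{j+1}$ whenever $S(i)=u_j$; (iii) a dummy move $(S,S)$. $T$ is reachable from $S$ if there is a finite sequence $S=S_0,\dots,S_t=T$ with each $(S_{k-1},S_k)$ a valid move. $H$ is universally solvable for $p$ robots if every configuration is reachable from every other. -}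

module Defs where

open import Data.Nat using (ℕ; zero; suc; _+_; _*_; _<_; _≤_; _<?_)
open import Data.Fin using (Fin; zero; suc; toℕ; fromℕ; fromℕ<; inject₁)
open import Data.Product using (Σ; ∃; ∃-syntax; _×_; _,_; proj₁)
open import Data.Sum using (_⊎_)
open import Data.List using (List)
open import Data.List.Membership.Propositional using (_∈_)
open import Function.Definitions using (Injective)
open import Relation.Binary.PropositionalEquality using (_≡_; _≢_)
open import Relation.Binary.Construct.Closure.ReflexiveTransitive using (Star)
open import Relation.Nullary using (yes; no)

csuc : ∀ {k} → Fin (suc k) → Fin (suc k)
csuc {k} j with suc (toℕ j) <? suc k
... | yes q = fromℕ< q
... | no _  = zero

Config : (N p : ℕ) → Set
Config N p = Σ (Fin p → Fin N) (Injective _≡_ _≡_)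

module _ {N : ℕ} (Adj : Fin N → Fin N → Set) {p : ℕ} where

  IsSimplePath : ∀ {k} → (Fin (suc k) → Fin N) → Set
  IsSimplePath {k} u =
    Injective _≡_ _≡_ u × (∀ (j : Fin k) → Adj (u (inject₁ j)) (u (suc j)))

  IsSimpleCycle : ∀ {k} → (Fin (suc k) → Fin N) → Set
  IsSimpleCycle {k} u =
    2 ≤ k × Injective _≡_ _≡_ u × (∀ (j : Fin (suc k)) → Adj (u j) (u (csuc j)))

  SimplePathMove : (S S' : Fin p → Fin N) → Set
  SimplePathMove S S' =
    ∃[ k ] Σ (Fin (suc k) → Fin N) λ u →
      IsSimplePath u
      × (∀ i → S i ≢ u (fromℕ k))
      × (∀ i → S' i ≢ u zero)
      × (∀ i → (∀ j → S i ≢ u j) → S' i ≡ S i)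
      × (∀ i (j : Fin k) → S i ≡ u (inject₁ j) → S' i ≡ u (suc j))

  SimpleRotationMove : (S S' : Fin p → Fin N) → Set
  SimpleRotationMove S S' =
    ∃[ k ] Σ (Fin (suc k) → Fin N) λ u →
      IsSimpleCycle u
      × (∀ j → ∃[ i ] S i ≡ u j)
      × (∀ j → ∃[ i ] S' i ≡ u j)
      × (∀ i → (∀ j → S i ≢ u j) → S' i ≡ S i)
      × (∀ i j → S i ≡ u j → S' i ≡ u (csuc j))

  DummyMove : (S S' : Fin p → Fin N) → Set
  DummyMove S S' = ∀ i → S' i ≡ S i

  ValidMove : Config N p → Config N p → Set
  ValidMove S S' =
    SimplePathMove (proj₁ S) (proj₁ S')
    ⊎ SimpleRotationMove (proj₁ S) (proj₁ S')
    ⊎ DummyMove (proj₁ S) (proj₁ S')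

  Reachable : Config N p → Config N p → Set
  Reachable S T = Star ValidMove S T

UniversallySolvable : {N : ℕ} → (Fin N → Fin N → Set) → ℕ → Set
UniversallySolvable {N} Adj p = ∀ (S T : Config N p) → Reachable Adj {p} S T

-- The graph Z_{α,β}: vertex 0 is the centre v; vertex 1 + r*(α+1) + t
-- (r < 2β+1, t ≤ α) is the t-th vertex (t = 0 adjacent to v) of path r.

zsize : ℕ → ℕ → ℕ
zsize α β = 1 + (2 * β + 1) * (α + 1)

ZEdge : ℕ → ℕ → ℕ → ℕ → Set
ZEdge α β a b =
  (a ≡ 0 × ∃[ r ] (r < 2 * β + 1 × b ≡ 1 + r * (α + 1)))
  ⊎ (∃[ r ] ∃[ t ] (r < 2 * β + 1 × t < α × a ≡ 1 + r * (α + 1) + t × b ≡ suc a))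

-- Z_{α,β} plus `a` new vertices (labels zsize α β, …, zsize α β + a - 1)
-- plus the new edges listed in E.
AugAdj : (α β a : ℕ) → List (Fin (zsize α β + a) × Fin (zsize α β + a))
       → Fin (zsize α β + a) → Fin (zsize α β + a) → Set
AugAdj α β a E x y =
  x ≢ y ×
  (ZEdge α β (toℕ x) (toℕ y) ⊎ ZEdge α β (toℕ y) (toℕ x)
   ⊎ (x , y) ∈ E ⊎ (y , x) ∈ E)

{-# OPTIONS --safe #-}
-- The at most β new edges have at most 2β endpoints, so one of the 2β+1 paths of Z_{α,β}
-- is untouched and remains a pendant path with α+1 vertices. There are at most α empty
-- vertices, so this path always carries a robot. A move shifts robots to neighbouring
-- vertices without letting two robots trade places, hence robots on a pendant path cannot
-- overtake each other and the outermost robot on it stays the outermost one forever. So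
-- the robot at the tip can never reach the centre, yet exchanging it with the robot at the
-- centre yields a valid target configuration.
module Submission where

open import Defs
open import Data.Nat using (ℕ; suc; _≤_; _<_; _+_; _*_; _∸_; _<?_; z≤n; s≤s; z<s; s≤s⁻¹; NonZero)
open import Data.Nat.Properties
open import Data.Nat.DivMod using (_/_; +-distrib-/-∣ˡ; m*n/n≡m; m<n⇒m/n≡0)
open import Data.Nat.Divisibility using (divides-refl)
open import Data.Fin using (Fin; zero; suc; toℕ; fromℕ<; inject₁; lower₁; splitAt; join; _↑ˡ_)
open import Data.Fin.Properties
  using (toℕ-injective; toℕ-fromℕ; toℕ-fromℕ<; toℕ-inject₁; toℕ-↑ˡ; ↑ˡ-injective; inject₁-lower₁;
         toℕ<n; any?; ¬∀⟶∃¬; join-splitAt; injective⇒≤)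
  renaming (_≟_ to _≟ᶠ_)
open import Data.Fin.Permutation using (Permutation; transpose; _⟨$⟩ʳ_)
open import Data.Product using (∃; _×_; _,_; proj₁; proj₂; map₂)
open import Data.Sum using (_⊎_; inj₁; inj₂; [_,_]′)
import Data.Sum as Sum
open import Data.Empty using (⊥; ⊥-elim)
open import Data.List using (List; length; lookup; map; _++_)
open import Data.List.Properties using (length-++; length-map)
open import Data.List.Membership.Propositional using (_∈_; _∉_)
open import Data.List.Membership.Propositional.Properties using (∈-++⁺ˡ; ∈-++⁺ʳ; ∈-map⁺)
open import Data.List.Membership.DecPropositional Data.Nat._≟_ using (_∈?_)
open import Data.List.Relation.Unary.Any using (index)
open import Data.List.Relation.Unary.Any.Properties using (lookup-index)
open import Function using (_∘_)
open import Function.Bundles using (Injection)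
open import Function.Definitions using (Injective)
open import Function.Properties.Inverse using (↔⇒↣)
open import Relation.Binary.Definitions using (Symmetric)
open import Relation.Binary.PropositionalEquality
open import Relation.Binary.Construct.Closure.ReflexiveTransitive using (ε; _◅_)
open import Relation.Nullary using (¬_; yes; no; contradiction)
open import Relation.Nullary.Decidable using (dec-true)

private
  variable
    N p : ℕ

record LocalMove (Adj : Fin N → Fin N → Set) (S S' : Fin p → Fin N) : Set where
  field
    stay-or-step : ∀ i → S' i ≡ S i ⊎ Adj (S i) (S' i)
    no-swap      : ∀ i j → S' i ≡ S j → S' j ≡ S i → i ≡ j

module _ {Adj : Fin N → Fin N → Set} {S S' : Fin p → Fin N} (S-inj : Injective _≡_ _≡_ S) where

  shift⇒localMove : {I : Set} (tail head : I → Fin N)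
    → (∀ m → Adj (tail m) (head m))
    → (∀ m m' → head m ≡ tail m' → head m' ≡ tail m → ⊥)
    → (∀ i → S' i ≡ S i ⊎ ∃ λ m → S i ≡ tail m × S' i ≡ head m)
    → LocalMove Adj S S'
  shift⇒localMove tail head edge no-2-cycle shift = record
    { stay-or-step = stay-or-step ; no-swap = no-swap }
    where
    stay-or-step : ∀ i → S' i ≡ S i ⊎ Adj (S i) (S' i)
    stay-or-step i with shift i
    ... | inj₁ stay              = inj₁ stay
    ... | inj₂ (m , from , to)   = inj₂ (subst₂ Adj (sym from) (sym to) (edge m))

    no-swap : ∀ i j → S' i ≡ S j → S' j ≡ S i → i ≡ j
    no-swap i j i↦j j↦i with shift i | shift j
    ... | inj₁ stay | _         = S-inj (trans (sym stay) i↦j)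
    ... | _         | inj₁ stay = sym (S-inj (trans (sym stay) j↦i))
    ... | inj₂ (m , from , to) | inj₂ (m' , from' , to') =
      ⊥-elim (no-2-cycle m m' (trans (sym to) (trans i↦j from')) (trans (sym to') (trans j↦i from)))

toℕ-csuc : ∀ {k} (j : Fin (suc k))
  → toℕ (csuc j) ≡ suc (toℕ j) ⊎ (toℕ (csuc j) ≡ 0 × toℕ j ≡ k)
toℕ-csuc {k} j with suc (toℕ j) <? suc k
... | yes j<k = inj₁ (toℕ-fromℕ< j<k)
... | no  j≮k =
  inj₂ (refl , ≤-antisym (s≤s⁻¹ (toℕ<n j)) (s≤s⁻¹ (≰⇒> λ 1+j≤k → j≮k (s≤s 1+j≤k))))

csuc∘csuc≢id : ∀ {k} → 2 ≤ k → (j : Fin (suc k)) → csuc (csuc j) ≢ j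
csuc∘csuc≢id {k} 2≤k j eq with toℕ-csuc j | toℕ-csuc (csuc j)
... | inj₁ j+1 | inj₁ j+2 =
  <⇒≢ (m<n⇒m<1+n (n<1+n _)) (trans (sym (cong toℕ eq)) (trans j+2 (cong suc j+1)))
... | inj₁ j+1 | inj₂ (j+2≡0 , j+1≡k) =
  1+n≰n (subst (2 ≤_)
    (trans (sym j+1≡k) (trans j+1 (cong suc (trans (sym (cong toℕ eq)) j+2≡0)))) 2≤k)
... | inj₂ (j+1≡0 , j≡k) | inj₁ j+2 =
  1+n≰n (subst (2 ≤_)
    (trans (sym j≡k) (trans (sym (cong toℕ eq)) (trans j+2 (cong suc j+1≡0)))) 2≤k)
... | inj₂ (j+1≡0 , _) | inj₂ (_ , j+1≡k) = n≮0 (subst (1 <_) (trans (sym j+1≡k) j+1≡0) 2≤k)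

validMove⇒localMove : ∀ {Adj : Fin N → Fin N → Set} (S S' : Config N p)
  → ValidMove Adj S S' → LocalMove Adj (proj₁ S) (proj₁ S')
validMove⇒localMove (S , S-inj) (S' , _)
                    (inj₁ (k , u , (u-inj , u-adj) , end-free , _ , off , on)) =
  shift⇒localMove S-inj (u ∘ inject₁) (u ∘ suc) u-adj no-2-cycle shift
  where
  no-2-cycle : ∀ m m' → u (suc m) ≡ u (inject₁ m') → u (suc m') ≡ u (inject₁ m) → ⊥
  no-2-cycle m m' m↦m' m'↦m = <⇒≢ (m<n⇒m<1+n (n<1+n (toℕ m)))
    (trans (step m'↦m) (cong suc (step m↦m')))
    where
    step : ∀ {x y} → u (suc x) ≡ u (inject₁ y) → toℕ y ≡ suc (toℕ x)
    step {x} {y} e = trans (sym (toℕ-inject₁ y)) (sym (cong toℕ (u-inj e)))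

  shift : ∀ i → S' i ≡ S i ⊎ ∃ λ m → S i ≡ u (inject₁ m) × S' i ≡ u (suc m)
  shift i with any? (λ m → S i ≟ᶠ u m)
  ... | no off-path = inj₁ (off i (λ m on-m → off-path (m , on-m)))
  ... | yes (m , at-m) = inj₂ (lower₁ m not-end , at , on i _ at)
    where
    not-end : k ≢ toℕ m
    not-end k≡m =
      end-free i (trans at-m (cong u (toℕ-injective (trans (sym k≡m) (sym (toℕ-fromℕ k))))))
    at : S i ≡ u (inject₁ (lower₁ m not-end))
    at = trans at-m (cong u (sym (inject₁-lower₁ m not-end)))
validMove⇒localMove (S , S-inj) (S' , _)
                    (inj₂ (inj₁ (k , u , (2≤k , u-inj , u-adj) , _ , _ , off , on))) =
  -- a cycle has at least three vertices, so no two robots on it trade places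
  shift⇒localMove S-inj u (u ∘ csuc) u-adj
    (λ m m' m↦m' m'↦m →
      csuc∘csuc≢id 2≤k m (u-inj (trans (cong (u ∘ csuc) (u-inj m↦m')) m'↦m)))
    shift
  where
  shift : ∀ i → S' i ≡ S i ⊎ ∃ λ m → S i ≡ u m × S' i ≡ u (csuc m)
  shift i with any? (λ m → S i ≟ᶠ u m)
  ... | no off-cycle   = inj₁ (off i (λ m on-m → off-cycle (m , on-m)))
  ... | yes (m , at-m) = inj₂ (m , at-m , on i m at-m)
validMove⇒localMove (S , S-inj) (S' , _) (inj₂ (inj₂ stay)) = record
  { stay-or-step = inj₁ ∘ stay
  ; no-swap      = λ i j i↦j _ → S-inj (trans (sym (stay i)) i↦j)
  }

disjoint-injective⇒+≤ : ∀ {m k} {f : Fin m → Fin N} {g : Fin k → Fin N}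
  → Injective _≡_ _≡_ f → Injective _≡_ _≡_ g → (∀ i j → f i ≢ g j) → m + k ≤ N
disjoint-injective⇒+≤ {m = m} {k} {f} {g} f-inj g-inj disjoint =
  injective⇒≤ {f = [ f , g ]′ ∘ splitAt m} λ {x} {y} eq →
    trans (sym (join-splitAt m k x))
      (trans (cong (join m k) (copair-injective {splitAt m x} {splitAt m y} eq)) (join-splitAt m k y))
  where
  copair-injective : ∀ {x y} → [ f , g ]′ x ≡ [ f , g ]′ y → x ≡ y
  copair-injective {inj₁ i} {inj₁ j} eq = cong inj₁ (f-inj eq)
  copair-injective {inj₁ i} {inj₂ j} eq = contradiction eq (disjoint i j)
  copair-injective {inj₂ i} {inj₁ j} eq = contradiction (sym eq) (disjoint j i)
  copair-injective {inj₂ i} {inj₂ j} eq = cong inj₂ (g-inj eq)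

short⇒∃∉ : ∀ {n} (xs : List ℕ) → length xs < n → ∃ λ (r : Fin n) → toℕ r ∉ xs
short⇒∃∉ {n} xs short = ¬∀⟶∃¬ n (λ r → toℕ r ∈ xs) (λ r → toℕ r ∈? xs) λ all∈ →
  <⇒≱ short (injective⇒≤ {f = index ∘ all∈} λ {r} {r'} eq →
    toℕ-injective (trans (lookup-index (all∈ r))
      (trans (cong (lookup xs) eq) (sym (lookup-index (all∈ r'))))))

module _ {N : ℕ} (Leg : Fin N → ℕ → Set) (root : Fin N) where

  Below : ℕ → Fin N → Set
  Below t y = (∃ λ s → t ≡ suc s × Leg y s) ⊎ (t ≡ 0 × y ≡ root)

-- Leg x t: x is vertex number t of a path hanging off root, vertex 0 being adjacent to root.
record IsPendantPath {N} (Adj : Fin N → Fin N → Set) (α : ℕ) (Leg : Fin N → ℕ → Set) (root : Fin N)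
       : Set where
  field
    bounded     : ∀ {x t} → Leg x t → t ≤ α
    total       : ∀ {t} → t ≤ α → ∃ λ x → Leg x t
    functional  : ∀ {x y t} → Leg x t → Leg y t → x ≡ y
    injective   : ∀ {x s t} → Leg x s → Leg x t → s ≡ t
    root-off    : ∀ {t} → ¬ Leg root t
    neighbours  : ∀ {x y t} → Leg x t → Adj x y → Leg y (suc t) ⊎ Below Leg root t y

module PendantPath {N} {Adj : Fin N → Fin N → Set} (Adj-sym : Symmetric Adj)
                   {α Leg root} (pendant : IsPendantPath Adj α Leg root) where
  open IsPendantPath pendant

  below-unique : ∀ {t y y'} → Below Leg root t y → Below Leg root t y' → y ≡ y'
  below-unique (inj₁ (_ , refl , y-at)) (inj₁ (_ , refl , y'-at)) = functional y-at y'-at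
  below-unique (inj₁ (_ , refl , _))    (inj₂ (() , _))
  below-unique (inj₂ (() , _))          (inj₁ (_ , refl , _))
  below-unique (inj₂ (_ , refl))        (inj₂ (_ , refl)) = refl

  below-lower : ∀ {t y s} → Below Leg root t y → Leg y s → s < t
  below-lower (inj₁ (s , refl , y-at)) y-at' = s≤s (≤-reflexive (injective y-at' y-at))
  below-lower (inj₂ (_ , refl)) y-at = contradiction y-at root-off

  leg-never-empty : ∀ {p} {S : Fin p → Fin N} → N ≤ p + α → Injective _≡_ _≡_ S
    → ¬ (∀ j s → ¬ Leg (S j) s)
  leg-never-empty {p} {S} holes S-inj empty = 1+n≰n (+-cancelˡ-≤ p _ _ (≤-trans p+α+1≤N holes))
    where
    vertex : Fin (suc α) → Fin N
    vertex t = proj₁ (total (s≤s⁻¹ (toℕ<n t)))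
    vertex-at : ∀ t → Leg (vertex t) (toℕ t)
    vertex-at t = proj₂ (total (s≤s⁻¹ (toℕ<n t)))
    p+α+1≤N : p + suc α ≤ N
    p+α+1≤N = disjoint-injective⇒+≤ S-inj
      (λ {t} {t'} eq →
        toℕ-injective (injective (vertex-at t) (subst (λ x → Leg x (toℕ t')) (sym eq) (vertex-at t'))))
      (λ j t eq → empty j (toℕ t) (subst (λ x → Leg x (toℕ t)) (sym eq) (vertex-at t)))

  Outermost : ∀ {p} → (Fin p → Fin N) → Fin p → ℕ → Set
  Outermost S i t = Leg (S i) t × (∀ j s → Leg (S j) s → s ≤ t)

  module _ {p} {S S' : Fin p → Fin N} (S-inj : Injective _≡_ _≡_ S) (S'-inj : Injective _≡_ _≡_ S')
           (holes : N ≤ p + α) (move : LocalMove Adj S S') {i t} (outer : Outermost S i t) where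
    open LocalMove move

    private
      i-at : Leg (S i) t
      i-at = proj₁ outer
      none-above : ∀ j s → Leg (S j) s → s ≤ t
      none-above = proj₂ outer

    only-i-above : ∀ j s → Leg (S' j) s → t < s → j ≡ i
    only-i-above j s j-at t<s with stay-or-step j
    ... | inj₁ stay = contradiction (none-above j s (subst (λ x → Leg x s) stay j-at)) (<⇒≱ t<s)
    ... | inj₂ step with neighbours j-at (Adj-sym step)
    ...   | inj₁ from-above = contradiction (none-above j (suc s) from-above) (<⇒≱ (m<n⇒m<1+n t<s))
    ...   | inj₂ (inj₁ (s' , refl , from-below)) =
      S-inj (functional from-below
        (subst (Leg (S i)) (≤-antisym (s≤s⁻¹ t<s) (none-above j s' from-below)) i-at))
    ...   | inj₂ (inj₂ (refl , _)) = contradiction t<s n≮0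

    outermost-from : ∀ {t'} → t ≤ t' → Leg (S' i) t' → Outermost S' i t'
    outermost-from t≤t' i-at' = i-at' , λ j s j-at → ≮⇒≥ λ t'<s →
      <⇒≢ t'<s (injective i-at'
        (subst (λ k → Leg (S' k) s) (only-i-above j s j-at (≤-<-trans t≤t' t'<s)) j-at))

    module _ (i-below : Below Leg root t (S' i)) where

      i-not-at : ∀ {j} → j ≡ i → ¬ Leg (S' j) t
      i-not-at refl at = <-irrefl refl (below-lower i-below at)

      vacated : ∀ j → ¬ Leg (S' j) t
      vacated j j-at with stay-or-step j
      ... | inj₁ stay = i-not-at (S-inj (functional (subst (λ x → Leg x t) stay j-at) i-at)) j-at
      ... | inj₂ step with neighbours j-at (Adj-sym step)
      ...   | inj₁ from-above = contradiction (none-above j (suc t) from-above) 1+n≰n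
      ...   | inj₂ from-below =
        i-not-at (sym (no-swap i j (below-unique i-below from-below) (functional j-at i-at))) j-at

      leg-below : ∀ j s → Leg (S' j) s → s < t
      leg-below j s j-at =
        ≰⇒> λ t≤s → [ t<s⇒⊥ , (λ { refl → vacated j j-at }) ]′ (m≤n⇒m<n∨m≡n t≤s)
        where
        t<s⇒⊥ : t < s → ⊥
        t<s⇒⊥ t<s with only-i-above j s j-at t<s
        ... | refl = <-asym t<s (below-lower i-below j-at)

    outermost-step : ∃ λ t' → Outermost S' i t'
    outermost-step with stay-or-step i
    ... | inj₁ stay = t , outermost-from ≤-refl (subst (λ x → Leg x t) (sym stay) i-at)
    ... | inj₂ step with neighbours i-at step
    ...   | inj₁ up = suc t , outermost-from (n≤1+n t) up
    ...   | inj₂ i-below@(inj₁ (s , refl , down)) =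
      s , down , λ j s' j-at → s≤s⁻¹ (leg-below i-below j s' j-at)
    ...   | inj₂ i-below@(inj₂ (refl , _)) =
      -- i stepped from vertex 0 onto root and left the path empty
      ⊥-elim (leg-never-empty holes S'-inj λ j s j-at → n≮0 (leg-below i-below j s j-at))

  outermost-reachable : ∀ {p} {S T : Config N p} → N ≤ p + α → Reachable Adj S T
    → ∀ {i t} → Outermost (proj₁ S) i t → ∃ λ t' → Outermost (proj₁ T) i t'
  outermost-reachable holes ε outer = _ , outer
  outermost-reachable {S = S} holes (_◅_ {j = S'} move rest) outer =
    outermost-reachable holes rest
      (proj₂ (outermost-step (proj₂ S) (proj₂ S') holes (validMove⇒localMove S S' move) outer))

  tip-stays-on-path : ∀ {p} {S T : Config N p} {i} → N ≤ p + α → Reachable Adj S T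
    → Leg (proj₁ S i) α → ∃ λ t → Leg (proj₁ T i) t
  tip-stays-on-path holes reach tip =
    map₂ proj₁ (outermost-reachable holes reach (tip , λ _ _ → bounded))

pathVertex : ℕ → ℕ → ℕ → ℕ
pathVertex α r t = 1 + r * (α + 1) + t

pathVertex-suc : ∀ α r t → pathVertex α r (suc t) ≡ suc (pathVertex α r t)
pathVertex-suc α r t = cong suc (+-suc (r * (α + 1)) t)

module _ (α : ℕ) where
  private instance
    α+1-nonZero : NonZero (α + 1)
    α+1-nonZero = subst NonZero (+-comm 1 α) _

  -- pathOf 0 = 0 is junk: the centre lies on no path.
  pathOf : ℕ → ℕ
  pathOf n = (n ∸ 1) / (α + 1)

  ≤⇒<α+1 : ∀ {t} → t ≤ α → t < α + 1
  ≤⇒<α+1 t≤α = ≤-<-trans t≤α (m<m+n α z<s)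

  pathOf-pathVertex : ∀ r {t} → t ≤ α → pathOf (pathVertex α r t) ≡ r
  pathOf-pathVertex r {t} t≤α = begin
    (r * (α + 1) + t) / (α + 1)             ≡⟨ +-distrib-/-∣ˡ t (divides-refl r) ⟩
    r * (α + 1) / (α + 1) + t / (α + 1)
      ≡⟨ cong₂ _+_ (m*n/n≡m r (α + 1)) (m<n⇒m/n≡0 (≤⇒<α+1 t≤α)) ⟩
    r + 0                                   ≡⟨ +-identityʳ r ⟩
    r                                       ∎
    where open ≡-Reasoning

  pathVertex-injective : ∀ {r r' t t'} → t ≤ α → t' ≤ α
    → pathVertex α r t ≡ pathVertex α r' t' → r ≡ r' × t ≡ t'
  pathVertex-injective {r} {r'} {t} {t'} t≤α t'≤α eq = r≡r' , +-cancelˡ-≡ (1 + r * (α + 1)) t t'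
    (subst (λ x → pathVertex α r t ≡ pathVertex α x t') (sym r≡r') eq)
    where
    r≡r' : r ≡ r'
    r≡r' = trans (sym (pathOf-pathVertex r t≤α)) (trans (cong pathOf eq) (pathOf-pathVertex r' t'≤α))

OnPath : ℕ → ℕ → ℕ → ℕ → Set
OnPath α r n t = t ≤ α × n ≡ pathVertex α r t

zEdge-neighbours : ∀ {α β r m n t} → OnPath α r m t → ZEdge α β m n ⊎ ZEdge α β n m
  → OnPath α r n (suc t) ⊎ (∃ λ s → t ≡ suc s × OnPath α r n s) ⊎ (t ≡ 0 × n ≡ 0)
zEdge-neighbours (_ , refl) (inj₁ (inj₁ (() , _)))
zEdge-neighbours {α} {r = r} {t = t} (t≤α , refl) (inj₁ (inj₂ (r' , t' , _ , t'<α , m≡ , refl)))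
  with pathVertex-injective α {r} {r'} {t} {t'} t≤α (<⇒≤ t'<α) m≡
... | refl , refl = inj₁ (t'<α , sym (pathVertex-suc α r t))
zEdge-neighbours {α} {r = r} {t = t} (t≤α , refl) (inj₂ (inj₁ (refl , r' , _ , m≡)))
  with pathVertex-injective α {r} {r'} {t} {0} t≤α z≤n (trans m≡ (sym (+-identityʳ _)))
... | _ , t≡0 = inj₂ (inj₂ (t≡0 , refl))
zEdge-neighbours {α} {r = r} {t = t} (t≤α , refl) (inj₂ (inj₂ (r' , t' , _ , t'<α , refl , m≡)))
  with pathVertex-injective α {r} {r'} {t} {suc t'} t≤α t'<α (trans m≡ (sym (pathVertex-suc α r' t')))
... | refl , refl = inj₂ (inj₁ (t' , refl , <⇒≤ t'<α , refl))

centre-off-path : ∀ α r {t} → ¬ OnPath α r 0 t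
centre-off-path _ _ (_ , ())

pathOf-onPath : ∀ {α r n t} → OnPath α r n t → pathOf α n ≡ r
pathOf-onPath {α} {r} (t≤α , refl) = pathOf-pathVertex α r t≤α

pathVertex<zsize : ∀ α β r {t} → r < 2 * β + 1 → t ≤ α → pathVertex α r t < zsize α β
pathVertex<zsize α β r {t} r<paths t≤α = s≤s (begin-strict
  r * (α + 1) + t         <⟨ +-monoʳ-< (r * (α + 1)) (≤⇒<α+1 α t≤α) ⟩
  r * (α + 1) + (α + 1)   ≡⟨ +-comm (r * (α + 1)) (α + 1) ⟩
  suc r * (α + 1)         ≤⟨ *-monoˡ-≤ (α + 1) r<paths ⟩
  (2 * β + 1) * (α + 1)   ∎)
  where open ≤-Reasoning

module _ (α β a : ℕ) (E : List (Fin (zsize α β + a) × Fin (zsize α β + a))) where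

  Untouched : ℕ → Set
  Untouched r = ∀ {x y t} → (x , y) ∈ E ⊎ (y , x) ∈ E → ¬ OnPath α r (toℕ x) t

  untouched-path : length E ≤ β → ∃ λ r → r < 2 * β + 1 × Untouched r
  untouched-path |E|≤β with short⇒∃∉ endpointPaths few-endpoints
    where
    endpointPaths : List ℕ
    endpointPaths = map (pathOf α ∘ toℕ ∘ proj₁) E ++ map (pathOf α ∘ toℕ ∘ proj₂) E
    few-endpoints : length endpointPaths < 2 * β + 1
    few-endpoints = begin-strict
      length endpointPaths
        ≡⟨ trans (length-++ (map _ E)) (cong₂ _+_ (length-map _ E) (length-map _ E)) ⟩
      length E + length E   ≤⟨ +-mono-≤ |E|≤β |E|≤β ⟩
      β + β                 ≡⟨ cong (β +_) (sym (+-identityʳ β)) ⟩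
      2 * β                 <⟨ m<m+n (2 * β) z<s ⟩
      2 * β + 1             ∎
      where open ≤-Reasoning
  ... | r , r∉ = toℕ r , toℕ<n r , λ where
    (inj₁ xy∈E) x-on →
      r∉ (∈-++⁺ˡ (subst (_∈ _) (pathOf-onPath x-on) (∈-map⁺ (pathOf α ∘ toℕ ∘ proj₁) xy∈E)))
    (inj₂ yx∈E) x-on →
      r∉ (∈-++⁺ʳ _ (subst (_∈ _) (pathOf-onPath x-on) (∈-map⁺ (pathOf α ∘ toℕ ∘ proj₂) yx∈E)))

  augAdj-sym : Symmetric (AugAdj α β a E)
  augAdj-sym (x≢y , edge) = x≢y ∘ sym , reverse edge
    where
    reverse : ∀ {A B C D : Set} → A ⊎ B ⊎ C ⊎ D → B ⊎ A ⊎ D ⊎ C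
    reverse (inj₁ xy)               = inj₂ (inj₁ xy)
    reverse (inj₂ (inj₁ yx))        = inj₁ yx
    reverse (inj₂ (inj₂ (inj₁ xy))) = inj₂ (inj₂ (inj₂ xy))
    reverse (inj₂ (inj₂ (inj₂ yx))) = inj₂ (inj₂ (inj₁ yx))

  augAdj-isPendantPath : ∀ {r} → r < 2 * β + 1 → Untouched r
    → IsPendantPath (AugAdj α β a E) α (λ x → OnPath α r (toℕ x)) zero
  augAdj-isPendantPath {r} r<paths untouched = record
    { bounded    = proj₁
    ; total      = λ t≤α → fromℕ< (on-path<N t≤α) , t≤α , toℕ-fromℕ< (on-path<N t≤α)
    ; functional = λ (_ , x≡) (_ , y≡) → toℕ-injective (trans x≡ (sym y≡))
    ; injective  = λ (s≤α , x≡s) (t≤α , x≡t) →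
                     proj₂ (pathVertex-injective α {r} {r} s≤α t≤α (trans (sym x≡s) x≡t))
    ; root-off   = centre-off-path α r
    ; neighbours = neighbours
    }
    where
    on-path<N : ∀ {t} → t ≤ α → pathVertex α r t < zsize α β + a
    on-path<N t≤α = <-≤-trans (pathVertex<zsize α β r r<paths t≤α) (m≤m+n _ a)

    centre-is-zero : ∀ {y t}
      → OnPath α r (toℕ y) (suc t)
        ⊎ (∃ λ s → t ≡ suc s × OnPath α r (toℕ y) s) ⊎ (t ≡ 0 × toℕ y ≡ 0)
      → OnPath α r (toℕ y) (suc t) ⊎ Below (λ x → OnPath α r (toℕ x)) zero t y
    centre-is-zero = Sum.map₂ (Sum.map₂ (map₂ toℕ-injective))

    neighbours : ∀ {x y t} → OnPath α r (toℕ x) t → AugAdj α β a E x y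
      → OnPath α r (toℕ y) (suc t) ⊎ Below (λ x → OnPath α r (toℕ x)) zero t y
    neighbours x-on (_ , inj₁ xy)        = centre-is-zero (zEdge-neighbours {β = β} {r} x-on (inj₁ xy))
    neighbours x-on (_ , inj₂ (inj₁ yx)) = centre-is-zero (zEdge-neighbours {β = β} {r} x-on (inj₂ yx))
    neighbours x-on (_ , inj₂ (inj₂ new)) = contradiction x-on (untouched new)

transpose-matchˡ : ∀ {n} (i j : Fin n) → transpose i j ⟨$⟩ʳ i ≡ j
transpose-matchˡ i j rewrite dec-true (i ≟ᶠ i) refl = refl

inclusion : ∀ {m} n → Config (m + n) m
inclusion n = (_↑ˡ n) , λ {i} {j} → ↑ˡ-injective n i j

permute : ∀ {N p} → Config N p → Permutation p p → Config N p
permute (S , S-inj) π = S ∘ (π ⟨$⟩ʳ_) , Injection.injective (↔⇒↣ π) ∘ S-inj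

theorem29 : (α β a : ℕ) → a ≤ α
            → (E : List (Fin (zsize α β + a) × Fin (zsize α β + a)))
            → length E ≤ β
            → ¬ UniversallySolvable (AugAdj α β a E) (zsize α β)
theorem29 α β a a≤α E |E|≤β solvable with untouched-path α β a E |E|≤β
... | r , r<paths , untouched = centre-off-path α r (proj₂ centre-on-path)
  where
  open PendantPath (augAdj-sym α β a E) (augAdj-isPendantPath α β a E r<paths untouched)

  tip<zsize : pathVertex α r α < zsize α β
  tip<zsize = pathVertex<zsize α β r r<paths ≤-refl
  tip : Fin (zsize α β)
  tip = fromℕ< tip<zsize

  start swapped : Config (zsize α β + a) (zsize α β)
  start   = inclusion a
  swapped = permute start (transpose tip zero)

  centre-on-path : ∃ (OnPath α r 0)
  centre-on-path = subst (λ x → ∃ (OnPath α r (toℕ x))) (cong (_↑ˡ a) (transpose-matchˡ tip zero))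
    (tip-stays-on-path (+-monoʳ-≤ (zsize α β) a≤α) (solvable start swapped)
      (≤-refl , trans (toℕ-↑ˡ tip a) (toℕ-fromℕ< tip<zsize)))
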